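{- Let $n=p_1p_2\cdots p_s$ be a Carmichael number, with $p_1,\ldots,p_s$ distinct primes. Fix $i\in\{1,\ldots,s\}$, put $M_i=\prod_{1\le j\le s,\ j\ne i}(p_j-1)$, and let $d_i$ be the smallest positive divisor of $\varphi(M_i)$ such that $p_i^{d_i}\equiv 1\pmod{M_i}$. Then $n\,p_i^{m d_i}$ is a weak Carmichael number for every positive integer $m$.
   Context: A Carmichael number is a composite positive integer $n$ with $a^{n-1}\equiv 1\pmod n$ for all integers $a$ coprime to $n$. A composite positive integer $n$ is called a weak Carmichael number if $\sum_{1\le k\le n-1,\ \gcd(k,n)=1} k^{n-1}\equiv \varphi(n)\pmod{n}$, where $\varphi$ is Euler's totient function. -}

module Defs where

open import Data.Nat using (ℕ; zero; suc; _+_; _*_; _∸_; _^_; _≤_; _<_; ∣_-_∣)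
open import Data.Nat.Divisibility using (_∣_)
open import Data.Nat.GCD using (gcd)
open import Data.Nat.Coprimality using (Coprime; coprime?)
open import Data.Nat.Primality using (Prime; Composite)
open import Data.Nat.Properties using (_≟_)
open import Data.List using (List; []; _∷_; map; length; filter; upTo; lookup; removeAt)
open import Data.Nat.ListAction using (sum; product)
open import Data.List.Relation.Unary.All using (All)
open import Data.List.Relation.Unary.Unique.Propositional using (Unique)
open import Data.Fin using (Fin)
open import Relation.Binary.PropositionalEquality using (_≡_)

_≡_[mod_] : ℕ → ℕ → ℕ → Set
a ≡ b [mod n ] = n ∣ ∣ a - b ∣

range1 : ℕ → List ℕ
range1 m = map suc (upTo m)

reducedResidues : ℕ → List ℕ
reducedResidues n = filter (λ k → coprime? k n) (range1 (n ∸ 1))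

φ : ℕ → ℕ
φ n = length (filter (λ k → coprime? k n) (range1 n))

Carmichael : ℕ → Set
Carmichael n = Composite n × (∀ a → Coprime a n → (a ^ (n ∸ 1)) ≡ 1 [mod n ])
  where open import Data.Product using (_×_)

WeakCarmichael : ℕ → Set
WeakCarmichael n =
  Composite n × (sum (map (λ k → k ^ (n ∸ 1)) (reducedResidues n)) ≡ φ n [mod n ])
  where open import Data.Product using (_×_)

M : (ps : List ℕ) → Fin (length ps) → ℕ
M ps i = product (map (λ p → p ∸ 1) (removeAt ps i))

module Submission where

-- Write n = p r with p = p_i, and put K = p^k (k = m d), N = n K, P = p K = p^(k+1).
-- From p^d ≡ 1 (mod M_i) we get q - 1 ∣ K - 1 for every prime q ∣ r, and p - 1 ∣ K - 1 holds
-- anyway; as N - 1 = (n - 1) K + (K - 1), the Carmichael property and Fermat's little theorem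
-- give a^(N-1) ≡ 1 modulo every prime factor of n, for every a coprime to N.
-- Group 1, …, N into the K-element classes x ≡ c (mod n). In a class of units the values
-- y = x^(N-1) are ≡ 1 (mod r); modulo P they are ≡ 1 (mod p) and pairwise distinct, because
-- x y = x^N ≡ c^K (mod P) by lifting the exponent. So modulo P they are the numbers 1 + t p
-- (t < K) in some order, whose sum is ≡ K (mod P) since K is odd (Carmichael numbers are odd).
-- Hence each class of units contributes K, its number of units, modulo N = r P, and the other
-- classes contribute nothing.

module FiniteSums where

  open import Algebra.Bundles using (CommutativeMonoid)
  import Algebra.Properties.CommutativeMonoid.Sum as CommutativeMonoidSum
  import Algebra.Properties.Semiring.Sum as SemiringSum
  open import Data.Bool.Base using (true; false; if_then_else_)
  open import Data.Fin.Base using (Fin; toℕ; fromℕ<; punchOut)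
  open import Data.Fin.Permutation using (Permutation′; permutation)
  open import Data.Fin.Properties
    using (any?; _≟_; toℕ<n; toℕ-fromℕ<; toℕ-injective; punchOut-injective; injective⇒≤)
  open import Data.List.Base using ([]; _∷_; map; filter; length; applyUpTo)
  open import Data.Nat.Base using (ℕ; zero; suc; _+_; _*_; _^_; _<_)
  open import Data.Nat.ListAction using (sum)
  open import Data.Nat.Properties
    using (+-0-commutativeMonoid; *-1-commutativeMonoid; +-*-semiring; +-assoc; +-comm; +-identityʳ; *-comm; 1+n≰n)
  open import Data.Nat.Tactic.RingSolver using (solve-∀)
  open import Data.Product using (∃; _,_; proj₁; proj₂)
  open import Function using (_∘_; id)
  open import Function.Definitions using (Injective)
  open import Level using (0ℓ)
  open import Relation.Binary.PropositionalEquality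
  open import Relation.Nullary using (does; yes; no; contradiction)
  open import Relation.Unary using (Pred; Decidable)

  -- A missed y could be punched out, injecting Fin (suc n) into Fin n.
  injective⇒surjective : ∀ {n} {τ : Fin n → Fin n} → Injective _≡_ _≡_ τ → ∀ y → ∃ λ x → τ x ≡ y
  injective⇒surjective {suc n} {τ} τ-injective y with any? (λ x → τ x ≟ y)
  ... | yes hit = hit
  ... | no miss = contradiction (injective⇒≤ punchOut∘τ-injective) 1+n≰n
    where
    y≢τ : ∀ x → y ≢ τ x
    y≢τ x y≡τx = miss (x , sym y≡τx)
    punchOut∘τ-injective : Injective _≡_ _≡_ (λ x → punchOut (y≢τ x))
    punchOut∘τ-injective eq = τ-injective (punchOut-injective (y≢τ _) (y≢τ _) eq)

  injective⇒permutation : ∀ {n} {τ : Fin n → Fin n} → Injective _≡_ _≡_ τ → Permutation′ n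
  injective⇒permutation {τ = τ} τ-injective =
    permutation τ (proj₁ ∘ surjective) (proj₂ ∘ surjective)
      (λ x → τ-injective (proj₂ (surjective (τ x))))
    where surjective = injective⇒surjective τ-injective

  module BigOperator (M : CommutativeMonoid 0ℓ 0ℓ) where

    open CommutativeMonoid M using (Carrier; _≈_; reflexive) renaming (sym to ≈-sym; trans to ≈-trans)
    open CommutativeMonoidSum M using (sum-cong-≗; sum-permute) renaming (sum to sumᶠ)

    big : ℕ → (ℕ → Carrier) → Carrier
    big K f = sumᶠ {K} (f ∘ toℕ)

    big-cong : ∀ K {f g} → (∀ {j} → j < K → f j ≡ g j) → big K f ≡ big K g
    big-cong K f≗g = sum-cong-≗ (λ i → f≗g (toℕ<n i))

    big-reindex : ∀ K f {t} → (∀ {j} → j < K → t j < K) →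
                  (∀ {i j} → i < K → j < K → t i ≡ t j → i ≡ j) → big K (f ∘ t) ≈ big K f
    big-reindex K f {t} t<K t-injective =
      ≈-trans (reflexive (sum-cong-≗ (λ i → cong f (sym (toℕ-fromℕ< (t<K (toℕ<n i)))))))
              (≈-sym (sum-permute (f ∘ toℕ) (injective⇒permutation τ-injective)))
      where
      τ : Fin K → Fin K
      τ i = fromℕ< (t<K (toℕ<n i))
      τ-injective : Injective _≡_ _≡_ τ
      τ-injective {i} {j} τi≡τj = toℕ-injective (t-injective (toℕ<n i) (toℕ<n j)
        (trans (sym (toℕ-fromℕ< _)) (trans (cong toℕ τi≡τj) (toℕ-fromℕ< _))))

  ∑ : ℕ → (ℕ → ℕ) → ℕ
  ∑ = BigOperator.big +-0-commutativeMonoid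

  syntax ∑ K (λ j → e) = ∑[ j < K ] e

  ∏ : ℕ → (ℕ → ℕ) → ℕ
  ∏ = BigOperator.big *-1-commutativeMonoid

  syntax ∏ K (λ j → e) = ∏[ j < K ] e

  open BigOperator +-0-commutativeMonoid public using () renaming (big-cong to ∑-cong; big-reindex to ∑-reindex)
  open BigOperator *-1-commutativeMonoid public using () renaming (big-reindex to ∏-reindex)

  open CommutativeMonoidSum +-0-commutativeMonoid using (∑-distrib-+; ∑-comm)
  open CommutativeMonoidSum *-1-commutativeMonoid using () renaming (∑-distrib-+ to ∏-distrib-*)
  open SemiringSum +-*-semiring using (*-distribʳ-sum)

  ∑-const-1 : ∀ K → ∑[ j < K ] 1 ≡ K
  ∑-const-1 zero    = refl
  ∑-const-1 (suc K) = cong suc (∑-const-1 K)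

  ∑-suc : ∀ K f → ∑[ j < K ] suc (f j) ≡ K + ∑ K f
  ∑-suc K f = trans (∑-distrib-+ {K} (λ _ → 1) (f ∘ toℕ)) (cong (_+ ∑ K f) (∑-const-1 K))

  ∑-*ʳ : ∀ K c f → ∑[ j < K ] (f j * c) ≡ ∑ K f * c
  ∑-*ʳ K c f = sym (*-distribʳ-sum {K} c (f ∘ toℕ))

  ∑-+ : ∀ a c f → ∑ (a + c) f ≡ ∑ a f + ∑[ j < c ] f (a + j)
  ∑-+ zero    c f = refl
  ∑-+ (suc a) c f = trans (cong (f 0 +_) (∑-+ a c (f ∘ suc))) (sym (+-assoc (f 0) _ _))

  ∑-dropLast : ∀ K f → f K ≡ 0 → ∑ (suc K) f ≡ ∑ K f
  ∑-dropLast K f fK≡0 = begin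
    ∑ (suc K) f               ≡⟨ cong (λ L → ∑ L f) (+-comm 1 K) ⟩
    ∑ (K + 1) f               ≡⟨ ∑-+ K 1 f ⟩
    ∑ K f + (f (K + 0) + 0)   ≡⟨ cong (∑ K f +_) (trans (+-identityʳ _) (cong f (+-identityʳ K))) ⟩
    ∑ K f + f K               ≡⟨ cong (∑ K f +_) fK≡0 ⟩
    ∑ K f + 0                 ≡⟨ +-identityʳ _ ⟩
    ∑ K f                     ∎
    where open ≡-Reasoning

  ∑-id : ∀ K → ∑[ j < K ] j * 2 + K ≡ K * K
  ∑-id zero    = refl
  ∑-id (suc K) = begin
    ∑[ j < K ] suc j * 2 + suc K           ≡⟨ cong (λ s → s * 2 + suc K) (∑-suc K id) ⟩
    (K + ∑[ j < K ] j) * 2 + suc K          ≡⟨ regroup K (∑[ j < K ] j) ⟩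
    (∑[ j < K ] j * 2 + K) + (K + K + 1)    ≡⟨ cong (_+ (K + K + 1)) (∑-id K) ⟩
    K * K + (K + K + 1)                    ≡⟨ square K ⟩
    suc K * suc K                          ∎
    where
    open ≡-Reasoning
    regroup : ∀ K s → (K + s) * 2 + suc K ≡ (s * 2 + K) + (K + K + 1)
    regroup = solve-∀
    square : ∀ K → K * K + (K + K + 1) ≡ suc K * suc K
    square = solve-∀

  ∑-rows : ∀ n K g → ∑[ x < K * n ] g x ≡ ∑[ j < K ] ∑[ b < n ] g (b + n * j)
  ∑-rows n zero    g = refl
  ∑-rows n (suc K) g = begin
    ∑ (n + K * n) g                                     ≡⟨ ∑-+ n (K * n) g ⟩
    ∑ n g + ∑[ x < K * n ] g (n + x)                    ≡⟨ cong (∑ n g +_) (∑-rows n K (λ x → g (n + x))) ⟩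
    ∑ n g + ∑[ j < K ] ∑[ b < n ] g (n + (b + n * j))   ≡⟨ cong₂ _+_ first-row later-rows ⟩
    ∑[ b < n ] g (b + n * 0) + ∑[ j < K ] ∑[ b < n ] g (b + n * suc j) ∎
    where
    open ≡-Reasoning
    b≡b+n*0 : ∀ b n → b ≡ b + n * 0
    b≡b+n*0 = solve-∀
    shift : ∀ n b j → n + (b + n * j) ≡ b + n * suc j
    shift = solve-∀
    first-row : ∑ n g ≡ ∑[ b < n ] g (b + n * 0)
    first-row = ∑-cong n (λ {b} _ → cong g (b≡b+n*0 b n))
    later-rows : ∑[ j < K ] ∑[ b < n ] g (n + (b + n * j)) ≡ ∑[ j < K ] ∑[ b < n ] g (b + n * suc j)
    later-rows = ∑-cong K (λ {j} _ → ∑-cong n (λ {b} _ → cong g (shift n b j)))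

  ∑-residueClasses : ∀ n K g → ∑[ x < n * K ] g x ≡ ∑[ b < n ] ∑[ j < K ] g (b + n * j)
  ∑-residueClasses n K g = begin
    ∑ (n * K) g                           ≡⟨ cong (λ L → ∑ L g) (*-comm n K) ⟩
    ∑ (K * n) g                           ≡⟨ ∑-rows n K g ⟩
    ∑[ j < K ] ∑[ b < n ] g (b + n * j)   ≡⟨ ∑-comm {K} {n} (λ j b → g (toℕ b + n * toℕ j)) ⟩
    ∑[ b < n ] ∑[ j < K ] g (b + n * j)   ∎
    where open ≡-Reasoning

  ∏-* : ∀ K f g → ∏[ j < K ] (f j * g j) ≡ ∏ K f * ∏ K g
  ∏-* K f g = ∏-distrib-* {K} (f ∘ toℕ) (g ∘ toℕ)

  ∏-const : ∀ K a → ∏[ j < K ] a ≡ a ^ K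
  ∏-const zero    a = refl
  ∏-const (suc K) a = cong (a *_) (∏-const K a)

  sum-map-applyUpTo : ∀ (g : ℕ → ℕ) f n → sum (map g (applyUpTo f n)) ≡ ∑[ j < n ] g (f j)
  sum-map-applyUpTo g f zero    = refl
  sum-map-applyUpTo g f (suc n) = cong (g (f 0) +_) (sum-map-applyUpTo g (f ∘ suc) n)

  sum-map-filter : ∀ {p} {P : Pred ℕ p} (P? : Decidable P) g xs →
    sum (map g (filter P? xs)) ≡ sum (map (λ x → if does (P? x) then g x else 0) xs)
  sum-map-filter P? g []       = refl
  sum-map-filter P? g (x ∷ xs) with does (P? x)
  ... | true  = cong (g x +_) (sum-map-filter P? g xs)
  ... | false = sum-map-filter P? g xs

  length-filter : ∀ {p} {P : Pred ℕ p} (P? : Decidable P) xs →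
    length (filter P? xs) ≡ sum (map (λ x → if does (P? x) then 1 else 0) xs)
  length-filter P? []       = refl
  length-filter P? (x ∷ xs) with does (P? x)
  ... | true  = cong suc (length-filter P? xs)
  ... | false = length-filter P? xs

module IntegerCongruence where

  open import Data.Integer.Base using (ℤ; +_; _+_; _-_; -_; _*_; _^_; ∣_∣; 0ℤ; 1ℤ)
  open import Data.Integer.Properties
  open import Data.Integer.Divisibility.Signed
  import Data.Integer.Coprimality as ℤ
  open import Data.Integer.Tactic.RingSolver using (solve-∀)
  open import Data.Nat.Base as ℕ using (ℕ; zero; suc; NonZero)
  open import Data.Nat.Coprimality using (Coprime)
  import Data.Nat.Divisibility as ℕ
  open import Data.Nat.DivMod using (_%_; _/_; m≡m%n+[m/n]*n)
  import Data.Nat.Properties as ℕ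
  open import Data.Sum using (inj₁; inj₂)
  open import Function using (_∘_)
  open import Level using (0ℓ)
  open import Relation.Binary.Bundles using (Setoid)
  open import Relation.Binary.PropositionalEquality
  import Relation.Binary.Reasoning.Setoid as SetoidReasoning
  open import Relation.Nullary using (contradiction)
  open import Defs using (_≡_[mod_])
  open FiniteSums using (∑; ∏)

  infix 4 _≡ᶻ_[mod_]

  -- A record rather than a synonym for  + m ∣ x - y,  so that x and y can be inferred.
  record _≡ᶻ_[mod_] (x y : ℤ) (m : ℕ) : Set where
    constructor congruent
    field
      modulus∣difference : + m ∣ x - y

  open _≡ᶻ_[mod_] public

  module _ {m : ℕ} where

    ≡ᶻ-reflexive : ∀ {x y} → x ≡ y → x ≡ᶻ y [mod m ]
    ≡ᶻ-reflexive {x} refl = congruent (divides 0ℤ (trans (+-inverseʳ x) (sym (*-zeroˡ (+ m)))))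

    ≡ᶻ-refl : ∀ {x} → x ≡ᶻ x [mod m ]
    ≡ᶻ-refl = ≡ᶻ-reflexive refl

    ≡ᶻ-sym : ∀ {x y} → x ≡ᶻ y [mod m ] → y ≡ᶻ x [mod m ]
    ≡ᶻ-sym {x} {y} (congruent m∣x-y) = congruent (subst (+ m ∣_) (lemma x y) (∣m⇒∣-m m∣x-y))
      where
      lemma : ∀ x y → - (x - y) ≡ y - x
      lemma = solve-∀

    ≡ᶻ-trans : ∀ {x y z} → x ≡ᶻ y [mod m ] → y ≡ᶻ z [mod m ] → x ≡ᶻ z [mod m ]
    ≡ᶻ-trans {x} {y} {z} (congruent m∣x-y) (congruent m∣y-z) =
      congruent (subst (+ m ∣_) (lemma x y z) (∣m∣n⇒∣m+n m∣x-y m∣y-z))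
      where
      lemma : ∀ x y z → (x - y) + (y - z) ≡ x - z
      lemma = solve-∀

    ≡ᶻ-+-cong : ∀ {x y u v} → x ≡ᶻ y [mod m ] → u ≡ᶻ v [mod m ] → x + u ≡ᶻ y + v [mod m ]
    ≡ᶻ-+-cong {x} {y} {u} {v} (congruent m∣x-y) (congruent m∣u-v) =
      congruent (subst (+ m ∣_) (lemma x y u v) (∣m∣n⇒∣m+n m∣x-y m∣u-v))
      where
      lemma : ∀ x y u v → (x - y) + (u - v) ≡ (x + u) - (y + v)
      lemma = solve-∀

    ≡ᶻ-*-cong : ∀ {x y u v} → x ≡ᶻ y [mod m ] → u ≡ᶻ v [mod m ] → x * u ≡ᶻ y * v [mod m ]
    ≡ᶻ-*-cong {x} {y} {u} {v} (congruent m∣x-y) (congruent m∣u-v) =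
      congruent (subst (+ m ∣_) (lemma x y u v) (∣m∣n⇒∣m+n (∣m⇒∣m*n u m∣x-y) (∣n⇒∣m*n y m∣u-v)))
      where
      lemma : ∀ x y u v → (x - y) * u + y * (u - v) ≡ x * u - y * v
      lemma = solve-∀

    ≡ᶻ-^-cong : ∀ {x y} e → x ≡ᶻ y [mod m ] → x ^ e ≡ᶻ y ^ e [mod m ]
    ≡ᶻ-^-cong zero    x≡y = ≡ᶻ-refl
    ≡ᶻ-^-cong (suc e) x≡y = ≡ᶻ-*-cong x≡y (≡ᶻ-^-cong e x≡y)

    ≡ᶻ-cancelˡ : ∀ {c x y} → Coprime m c → + c * x ≡ᶻ + c * y [mod m ] → x ≡ᶻ y [mod m ]
    ≡ᶻ-cancelˡ {c} {x} {y} m⊥c (congruent m∣cx-cy) = congruent (∣ᵤ⇒∣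
      (ℤ.coprime-divisor (+ m) (+ c) (x - y) m⊥c (∣⇒∣ᵤ (subst (+ m ∣_) (lemma (+ c) x y) m∣cx-cy))))
      where
      lemma : ∀ c x y → c * x - c * y ≡ c * (x - y)
      lemma = solve-∀

  ≡ᶻ-setoid : ℕ → Setoid 0ℓ 0ℓ
  ≡ᶻ-setoid m = record
    { Carrier       = ℤ
    ; _≈_           = _≡ᶻ_[mod m ]
    ; isEquivalence = record { refl = ≡ᶻ-refl ; sym = ≡ᶻ-sym ; trans = ≡ᶻ-trans }
    }

  module ≡ᶻ-Reasoning (m : ℕ) = SetoidReasoning (≡ᶻ-setoid m)

  ≡ᶻ-weaken : ∀ {m k x y} → m ℕ.∣ k → x ≡ᶻ y [mod k ] → x ≡ᶻ y [mod m ]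
  ≡ᶻ-weaken m∣k (congruent k∣x-y) = congruent (∣-trans (∣ᵤ⇒∣ m∣k) k∣x-y)

  ≡ᶻ-combine : ∀ {k m x y} → Coprime k m →
               x ≡ᶻ y [mod k ] → x ≡ᶻ y [mod m ] → x ≡ᶻ y [mod k ℕ.* m ]
  ≡ᶻ-combine {k} {m} k⊥m (congruent k∣x-y) (congruent (divides a x-y≡am)) =
    congruent (subst₂ _∣_ (sym (pos-* k m)) (sym x-y≡am) (*-monoˡ-∣ (+ m) k∣a))
    where
    k∣a : + k ∣ a
    k∣a = ∣ᵤ⇒∣ (ℤ.coprime-divisor (+ k) (+ m) a k⊥m
      (∣⇒∣ᵤ (subst (+ k ∣_) (trans x-y≡am (*-comm a (+ m))) k∣x-y)))

  ≡ᶻ-cancel-modulus : ∀ {c m x y} .{{_ : NonZero c}} →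
                      + c * x ≡ᶻ + c * y [mod c ℕ.* m ] → x ≡ᶻ y [mod m ]
  ≡ᶻ-cancel-modulus {c} {m} {x} {y} (congruent cm∣cx-cy) =
    congruent (*-cancelˡ-∣ (+ c) (subst₂ _∣_ (pos-* c m) (lemma (+ c) x y) cm∣cx-cy))
    where
    lemma : ∀ c x y → c * x - c * y ≡ c * (x - y)
    lemma = solve-∀

  ∣+m-+n∣≡∣m-n∣ : ∀ m n → ∣ + m - + n ∣ ≡ ℕ.∣ m - n ∣
  ∣+m-+n∣≡∣m-n∣ m n with ℕ.≤-total m n
  ... | inj₁ m≤n = trans (cong ∣_∣ ([+m]-[+n]≡m⊖n m n))
                     (trans (∣⊖∣-≤ m≤n) (sym (ℕ.m≤n⇒∣m-n∣≡n∸m m≤n)))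
  ... | inj₂ n≤m = trans (cong ∣_∣ ([+m]-[+n]≡m⊖n m n)) (trans (∣m⊖n∣≡∣n⊖m∣ m n)
                     (trans (∣⊖∣-≤ n≤m) (sym (ℕ.m≤n⇒∣n-m∣≡n∸m n≤m))))

  ≡[mod]⇒≡ᶻ : ∀ {a b m} → a ≡ b [mod m ] → + a ≡ᶻ + b [mod m ]
  ≡[mod]⇒≡ᶻ {a} {b} = congruent ∘ ∣ᵤ⇒∣ ∘ subst (_ ℕ.∣_) (sym (∣+m-+n∣≡∣m-n∣ a b))

  ≡ᶻ⇒≡[mod] : ∀ {a b m} → + a ≡ᶻ + b [mod m ] → a ≡ b [mod m ]
  ≡ᶻ⇒≡[mod] {a} {b} = subst (_ ℕ.∣_) (∣+m-+n∣≡∣m-n∣ a b) ∘ ∣⇒∣ᵤ ∘ modulus∣difference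

  ∣⇒≡ᶻ0 : ∀ {m a} → m ℕ.∣ a → + a ≡ᶻ 0ℤ [mod m ]
  ∣⇒≡ᶻ0 {m} {a} m∣a = ≡[mod]⇒≡ᶻ (subst (m ℕ.∣_) (sym (ℕ.∣-∣-identityʳ a)) m∣a)

  %-≡ᶻ : ∀ x m .{{_ : NonZero m}} → + (x % m) ≡ᶻ + x [mod m ]
  %-≡ᶻ x m = ≡[mod]⇒≡ᶻ (subst (m ℕ.∣_) (sym distance) (ℕ.n∣m*n (x / m)))
    where
    distance : ℕ.∣ x % m - x ∣ ≡ x / m ℕ.* m
    distance = trans (cong (λ y → ℕ.∣ x % m - y ∣) (m≡m%n+[m/n]*n x m)) (ℕ.∣m-m+n∣≡n (x % m) _)

  ≡ᶻ⇒≡ : ∀ {m x y} → x ℕ.< m → y ℕ.< m → + x ≡ᶻ + y [mod m ] → x ≡ y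
  ≡ᶻ⇒≡ {x = x} {y} x<m y<m x≡y = ℕ.∣m-n∣≡0⇒m≡n
    (<∧∣⇒≡0 (ℕ.≤-<-trans (ℕ.∣m-n∣≤m⊔n x y) (ℕ.⊔-lub x<m y<m)) (≡ᶻ⇒≡[mod] x≡y))
    where
    <∧∣⇒≡0 : ∀ {m n} → n ℕ.< m → m ℕ.∣ n → n ≡ 0
    <∧∣⇒≡0 {n = zero}  _   _   = refl
    <∧∣⇒≡0 {n = suc n} n<m m∣n = contradiction m∣n (ℕ.>⇒∤ n<m)

  pos-^ : ∀ a e → + (a ℕ.^ e) ≡ (+ a) ^ e
  pos-^ a zero    = refl
  pos-^ a (suc e) = trans (pos-* a (a ℕ.^ e)) (cong (+ a *_) (pos-^ a e))

  ^-≡ᶻ-1 : ∀ {m} x e {f} → x ^ e ≡ᶻ 1ℤ [mod m ] → e ℕ.∣ f → x ^ f ≡ᶻ 1ℤ [mod m ]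
  ^-≡ᶻ-1 {m} x e xᵉ≡1 (ℕ.divides c refl) = subst₂ (_≡ᶻ_[mod m ])
    (trans (^-*-assoc x e c) (cong (x ^_) (ℕ.*-comm e c))) (^-zeroˡ c) (≡ᶻ-^-cong c xᵉ≡1)

  ∑-≡ᶻ : ∀ {m} K {f g} → (∀ {j} → j ℕ.< K → + f j ≡ᶻ + g j [mod m ]) →
         + ∑ K f ≡ᶻ + ∑ K g [mod m ]
  ∑-≡ᶻ     zero    f≡g = ≡ᶻ-refl
  ∑-≡ᶻ {m} (suc K) {f} {g} f≡g = subst₂ (_≡ᶻ_[mod m ]) (sym (pos-+ (f 0) _)) (sym (pos-+ (g 0) _))
    (≡ᶻ-+-cong (f≡g ℕ.z<s) (∑-≡ᶻ K (f≡g ∘ ℕ.s<s)))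

  ∏-≡ᶻ : ∀ {m} K {f g} → (∀ {j} → j ℕ.< K → + f j ≡ᶻ + g j [mod m ]) →
         + ∏ K f ≡ᶻ + ∏ K g [mod m ]
  ∏-≡ᶻ     zero    f≡g = ≡ᶻ-refl
  ∏-≡ᶻ {m} (suc K) {f} {g} f≡g = subst₂ (_≡ᶻ_[mod m ]) (sym (pos-* (f 0) _)) (sym (pos-* (g 0) _))
    (≡ᶻ-*-cong (f≡g ℕ.z<s) (∏-≡ᶻ K (f≡g ∘ ℕ.s<s)))

module Arithmetic where

  open import Data.Integer.Base using (+_; _-_; -_; _*_; _^_; 1ℤ)
  open import Data.Integer.Divisibility.Signed using (divides; ∣⇒∣ᵤ)
  open import Data.Integer.Properties using (*-identityˡ; *-identityʳ; ^-zeroˡ)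
  open import Data.List.Base using (List; []; _∷_)
  open import Data.List.Relation.Unary.All as All using (All; _∷_)
  open import Data.List.Relation.Unary.AllPairs using (_∷_)
  open import Data.List.Membership.Propositional using (_∈_)
  open import Data.List.Relation.Unary.Any using (here; there)
  open import Data.List.Relation.Unary.Unique.Propositional using (Unique)
  open import Data.Nat.Base as ℕ using (ℕ; zero; suc; NonZero)
  open import Data.Nat.Coprimality as Coprimality using (Coprime; coprime-divisor)
  import Data.Nat.Divisibility as ℕ
  open import Data.Nat.ListAction using (product)
  open import Data.Nat.Primality
    using (Prime; Composite; composite; euclidsLemma; prime⇒irreducible; prime⇒nonTrivial; ¬prime[1])
  open import Data.Nat.Primality.Factorisation using (factorisationHasAllPrimeFactors)
  import Data.Nat.Properties as ℕ
  open import Data.Product using (_,_)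
  open import Data.Sum using (inj₁; inj₂)
  open import Function using (_∘_)
  open import Relation.Binary.PropositionalEquality
  open import Relation.Nullary using (¬_; contradiction)
  open import Defs using (Carmichael; _≡_[mod_])
  open FiniteSums using (∏)
  open IntegerCongruence

  coprime-∣ʳ : ∀ {a b c} → Coprime a b → c ℕ.∣ b → Coprime a c
  coprime-∣ʳ a⊥b c∣b (d∣a , d∣c) = a⊥b (d∣a , ℕ.∣-trans d∣c c∣b)

  coprime-*ʳ : ∀ {a b c} → Coprime a b → Coprime a c → Coprime a (b ℕ.* c)
  coprime-*ʳ {a} {b} a⊥b a⊥c {d} (d∣a , d∣bc) = a⊥c (d∣a , coprime-divisor d⊥b d∣bc)
    where
    d⊥b : Coprime d b
    d⊥b (e∣d , e∣b) = a⊥b (ℕ.∣-trans e∣d d∣a , e∣b)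

  coprime-^ʳ : ∀ {a b} e → Coprime a b → Coprime a (b ℕ.^ e)
  coprime-^ʳ {a} zero    _   = Coprimality.sym (Coprimality.1-coprimeTo a)
  coprime-^ʳ     (suc e) a⊥b = coprime-*ʳ a⊥b (coprime-^ʳ e a⊥b)

  coprime-^ˡ : ∀ {a b} e → Coprime a b → Coprime (a ℕ.^ e) b
  coprime-^ˡ e = Coprimality.sym ∘ coprime-^ʳ e ∘ Coprimality.sym

  coprime-+-* : ∀ {c n} j → Coprime c n → Coprime (c ℕ.+ n ℕ.* j) n
  coprime-+-* {c} {n} j c⊥n {d} (d∣c+nj , d∣n) =
    c⊥n (ℕ.∣m+n∣m⇒∣n (subst (d ℕ.∣_) (ℕ.+-comm c (n ℕ.* j)) d∣c+nj) (ℕ.∣m⇒∣m*n j d∣n) ,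
         d∣n)

  coprime-+-*⁻ : ∀ {c n m} j → n ℕ.∣ m → Coprime (c ℕ.+ n ℕ.* j) m → Coprime c n
  coprime-+-*⁻ j n∣m c+nj⊥m (d∣c , d∣n) =
    c+nj⊥m (ℕ.∣m∣n⇒∣m+n d∣c (ℕ.∣m⇒∣m*n j d∣n) , ℕ.∣-trans d∣n n∣m)

  ¬coprime-self : ∀ {n} → 1 ℕ.< n → ¬ Coprime n n
  ¬coprime-self 1<n n⊥n = ℕ.<-irrefl (sym (n⊥n (ℕ.∣-refl , ℕ.∣-refl))) 1<n

  coprime⇒∤ : ∀ {a m q} → Coprime a m → q ℕ.∣ m → 1 ℕ.< q → ¬ q ℕ.∣ a
  coprime⇒∤ a⊥m q∣m 1<q q∣a = ℕ.<-irrefl (sym (a⊥m (q∣a , q∣m))) 1<q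

  prime>1 : ∀ {p} → Prime p → 1 ℕ.< p
  prime>1 {p} p-prime = ℕ.nonTrivial⇒n>1 p {{prime⇒nonTrivial p-prime}}

  prime∤⇒coprime : ∀ {p n} → Prime p → ¬ p ℕ.∣ n → Coprime p n
  prime∤⇒coprime p-prime p∤n (d∣p , d∣n) with prime⇒irreducible p-prime d∣p
  ... | inj₁ d≡1  = d≡1
  ... | inj₂ refl = contradiction d∣n p∤n

  prime∤∏ : ∀ {q} K f → Prime q → (∀ {j} → j ℕ.< K → ¬ q ℕ.∣ f j) → ¬ q ℕ.∣ ∏ K f
  prime∤∏ zero    f q-prime _   q∣1 = ¬prime[1] (subst Prime (ℕ.∣1⇒≡1 q∣1) q-prime)
  prime∤∏ (suc K) f q-prime q∤f q∣∏ with euclidsLemma (f 0) (∏[ j < K ] f (suc j)) q-prime q∣∏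
  ... | inj₁ q∣f0 = q∤f ℕ.z<s q∣f0
  ... | inj₂ q∣∏′ = prime∤∏ K (f ∘ suc) q-prime (q∤f ∘ ℕ.s<s) q∣∏′

  composite⇒>2 : ∀ {n} → Composite n → 2 ℕ.< n
  composite⇒>2 (composite {d} d<n _) = ℕ.≤-<-trans (ℕ.nonTrivial⇒n>1 d) d<n

  ≡ᶻ-product : ∀ {qs x y} → All Prime qs → Unique qs → (∀ {q} → q ∈ qs → x ≡ᶻ y [mod q ]) →
               x ≡ᶻ y [mod product qs ]
  ≡ᶻ-product {[]}     {x} {y} _ _ _ = congruent (divides (x - y) (sym (*-identityʳ (x - y))))
  ≡ᶻ-product {q ∷ qs} (q-prime ∷ qs-prime) (q∉qs ∷ qs-unique) x≡y =
    ≡ᶻ-combine (prime∤⇒coprime q-prime q∤∏) (x≡y (here refl))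
      (≡ᶻ-product qs-prime qs-unique (x≡y ∘ there))
    where
    q∤∏ : ¬ q ℕ.∣ product qs
    q∤∏ q∣∏ = All.lookup q∉qs (factorisationHasAllPrimeFactors q-prime q∣∏ qs-prime) refl

  ≡ᶻ1⇒∤ : ∀ {m y} → 1 ℕ.< m → + y ≡ᶻ 1ℤ [mod m ] → ¬ m ℕ.∣ y
  ≡ᶻ1⇒∤ {m} {y} 1<m y≡1 m∣y = contradiction
    (≡ᶻ⇒≡ (ℕ.<-trans ℕ.z<s 1<m) 1<m (≡ᶻ-trans (≡ᶻ-sym (∣⇒≡ᶻ0 m∣y)) y≡1)) λ ()

  -1^odd : ∀ c → (- 1ℤ) ^ suc (c ℕ.* 2) ≡ - 1ℤ
  -1^odd zero    = refl
  -1^odd (suc c) = cong (λ z → - 1ℤ * (- 1ℤ * z)) (-1^odd c)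

  -- If n were even, then n - 1 would be odd and (n - 1)^(n - 1) ≡ (-1)^(n - 1) = -1, so n ∣ 2.
  carmichael⇒odd : ∀ {n} → Carmichael n → ¬ 2 ℕ.∣ n
  carmichael⇒odd (n-composite , _)  (ℕ.divides zero refl) = contradiction (composite⇒>2 n-composite) λ ()
  carmichael⇒odd {n} (n-composite , n-fermat) (ℕ.divides (suc c) refl) =
    contradiction (ℕ.∣⇒≤ n∣2) (ℕ.<⇒≱ (composite⇒>2 n-composite))
    where
    n-1⊥n : Coprime (suc (c ℕ.* 2)) n
    n-1⊥n {d} (d∣n-1 , d∣n) =
      ℕ.∣1⇒≡1 (ℕ.∣m+n∣m⇒∣n (subst (d ℕ.∣_) (ℕ.+-comm 1 (suc (c ℕ.* 2))) d∣n) d∣n-1)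
    n-1≡-1 : + suc (c ℕ.* 2) ≡ᶻ - 1ℤ [mod n ]
    n-1≡-1 = congruent (divides 1ℤ (trans (cong +_ (ℕ.+-comm (suc (c ℕ.* 2)) 1)) (sym (*-identityˡ (+ n)))))
    -1≡1 : - 1ℤ ≡ᶻ 1ℤ [mod n ]
    -1≡1 = let open ≡ᶻ-Reasoning n in begin
      - 1ℤ                                ≡⟨ -1^odd c ⟨
      (- 1ℤ) ^ suc (c ℕ.* 2)              ≈⟨ ≡ᶻ-^-cong (suc (c ℕ.* 2)) n-1≡-1 ⟨
      (+ suc (c ℕ.* 2)) ^ suc (c ℕ.* 2)   ≡⟨ pos-^ (suc (c ℕ.* 2)) (suc (c ℕ.* 2)) ⟨
      + (suc (c ℕ.* 2) ℕ.^ suc (c ℕ.* 2)) ≈⟨ ≡[mod]⇒≡ᶻ (n-fermat _ n-1⊥n) ⟩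
      1ℤ                                  ∎
    n∣2 : n ℕ.∣ 2
    n∣2 = ∣⇒∣ᵤ (modulus∣difference -1≡1)

  ∣∸1⇒≡1[mod] : ∀ {m a} → 0 ℕ.< a → m ℕ.∣ a ℕ.∸ 1 → a ≡ 1 [mod m ]
  ∣∸1⇒≡1[mod] 0<a = subst (_ ℕ.∣_) (sym (ℕ.m≤n⇒∣n-m∣≡n∸m 0<a))

  ≡1[mod]⇒∣∸1 : ∀ {m a} → 0 ℕ.< a → a ≡ 1 [mod m ] → m ℕ.∣ a ℕ.∸ 1
  ≡1[mod]⇒∣∸1 0<a = subst (_ ℕ.∣_) (ℕ.m≤n⇒∣n-m∣≡n∸m 0<a)

  m∸1∣mᵏ∸1 : ∀ {m} k → 0 ℕ.< m → m ℕ.∸ 1 ℕ.∣ m ℕ.^ k ℕ.∸ 1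
  m∸1∣mᵏ∸1 {m} k 0<m = ≡1[mod]⇒∣∸1 (ℕ.m^n>0 m {{ℕ.>-nonZero 0<m}} k) (≡ᶻ⇒≡[mod]
    (subst₂ (_≡ᶻ_[mod m ℕ.∸ 1 ]) (sym (pos-^ m k)) (^-zeroˡ k)
      (≡ᶻ-^-cong k (≡[mod]⇒≡ᶻ (∣∸1⇒≡1[mod] 0<m ℕ.∣-refl)))))

  ^≡1⇒^[m*d]≡1 : ∀ {M a d} m → (a ℕ.^ d) ≡ 1 [mod M ] → (a ℕ.^ (m ℕ.* d)) ≡ 1 [mod M ]
  ^≡1⇒^[m*d]≡1 {M} {a} {d} m aᵈ≡1 = ≡ᶻ⇒≡[mod] (subst (_≡ᶻ 1ℤ [mod M ]) (sym (pos-^ a (m ℕ.* d)))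
    (^-≡ᶻ-1 (+ a) d (subst (_≡ᶻ 1ℤ [mod M ]) (pos-^ a d) (≡[mod]⇒≡ᶻ aᵈ≡1)) (ℕ.n∣m*n m)))

  m*n∸1≡[m∸1]*n+[n∸1] : ∀ m n .{{_ : NonZero m}} .{{_ : NonZero n}} →
                        m ℕ.* n ℕ.∸ 1 ≡ (m ℕ.∸ 1) ℕ.* n ℕ.+ (n ℕ.∸ 1)
  m*n∸1≡[m∸1]*n+[n∸1] (suc m) (suc n) = ℕ.+-comm n (m ℕ.* suc n)

module Fermat where

  open import Data.Integer.Base using (+_; _*_; _^_; 1ℤ)
  open import Data.Integer.Properties using (pos-*; *-identityʳ; *-comm)
  open import Data.Nat.Base as ℕ using (ℕ; suc)
  open import Data.Nat.Coprimality using (Coprime)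
  import Data.Nat.Divisibility as ℕ
  open import Data.Nat.DivMod using (_%_; m%n<n)
  open import Data.Nat.Primality using (Prime; euclidsLemma)
  import Data.Nat.Properties as ℕ
  open import Data.Sum using (inj₁; inj₂)
  open import Function using (_∘_)
  open import Relation.Binary.PropositionalEquality
  open import Relation.Nullary using (¬_)
  open FiniteSums using (∏; ∏-reindex; ∏-*; ∏-const)
  open IntegerCongruence
  open Arithmetic using (prime∤⇒coprime; prime∤∏)

  -- j ↦ a (j + 1) mod q permutes 1, …, q - 1, so aᵠ⁻¹ (q - 1)! ≡ (q - 1)! (mod q).
  fermat : ∀ {q a} → Prime q → ¬ q ℕ.∣ a → (+ a) ^ (q ℕ.∸ 1) ≡ᶻ 1ℤ [mod q ]
  fermat {suc K} {a} q-prime q∤a = ≡ᶻ-sym (≡ᶻ-cancelˡ q⊥W W≡W*aᴷ)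
    where
    q = suc K
    residue : ℕ → ℕ
    residue j = a ℕ.* suc j % q
    residue≢0 : ∀ {j} → j ℕ.< K → residue j ≢ 0
    residue≢0 {j} j<K residue≡0
      with euclidsLemma a (suc j) q-prime (ℕ.m%n≡0⇒n∣m (a ℕ.* suc j) q residue≡0)
    ... | inj₁ q∣a   = q∤a q∣a
    ... | inj₂ q∣1+j = ℕ.>⇒∤ (ℕ.s<s j<K) q∣1+j
    t : ℕ → ℕ
    t j = ℕ.pred (residue j)
    suc-t : ∀ {j} → j ℕ.< K → suc (t j) ≡ residue j
    suc-t j<K = ℕ.suc-pred _ {{ℕ.≢-nonZero (residue≢0 j<K)}}
    t<K : ∀ {j} → j ℕ.< K → t j ℕ.< K
    t<K {j} j<K = ℕ.s<s⁻¹ (subst (ℕ._< q) (sym (suc-t j<K)) (m%n<n (a ℕ.* suc j) q))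
    t-injective : ∀ {i j} → i ℕ.< K → j ℕ.< K → t i ≡ t j → i ≡ j
    t-injective {i} {j} i<K j<K ti≡tj = ℕ.suc-injective (≡ᶻ⇒≡ (ℕ.s<s i<K) (ℕ.s<s j<K)
      (≡ᶻ-cancelˡ (prime∤⇒coprime q-prime q∤a) (subst₂ (_≡ᶻ_[mod q ]) (pos-* a (suc i)) (pos-* a (suc j))
        (≡ᶻ-trans (≡ᶻ-sym (%-≡ᶻ _ q))
          (≡ᶻ-trans (≡ᶻ-reflexive (cong +_ (trans (sym (suc-t i<K)) (trans (cong suc ti≡tj) (suc-t j<K)))))
            (%-≡ᶻ _ q))))))
    W : ℕ
    W = ∏[ j < K ] suc j
    q⊥W : Coprime q W
    q⊥W = prime∤⇒coprime q-prime (prime∤∏ K suc q-prime (λ j<K → ℕ.>⇒∤ (ℕ.s<s j<K)))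
    W≡aᴷ*W : + W ≡ᶻ + (a ℕ.^ K ℕ.* W) [mod q ]
    W≡aᴷ*W = subst₂ (_≡ᶻ_[mod q ]) (cong +_ (∏-reindex K suc t<K t-injective))
      (cong +_ (trans (∏-* K (λ _ → a) suc) (cong (ℕ._* W) (∏-const K a))))
      (∏-≡ᶻ K {suc ∘ t} λ {j} j<K →
        ≡ᶻ-trans (≡ᶻ-reflexive (cong +_ (suc-t j<K))) (%-≡ᶻ (a ℕ.* suc j) q))
    W≡W*aᴷ : + W * 1ℤ ≡ᶻ + W * (+ a) ^ K [mod q ]
    W≡W*aᴷ = subst₂ (_≡ᶻ_[mod q ]) (sym (*-identityʳ (+ W)))
      (trans (pos-* (a ℕ.^ K) W) (trans (*-comm _ (+ W)) (cong (+ W *_) (pos-^ a K)))) W≡aᴷ*W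

module LiftingTheExponent where

  open import Data.Integer.Base using (ℤ; +_; _+_; _-_; _*_; _^_; 0ℤ; 1ℤ)
  open import Data.Integer.Divisibility.Signed
    using (_∣_; divides; ∣-trans; ∣m∣n⇒∣m+n; *-monoˡ-∣; *-monoʳ-∣)
  open import Data.Integer.Properties using (pos-*; *-comm; ^-identityʳ; ^-*-assoc)
  open import Data.Integer.Tactic.RingSolver using (solve-∀)
  open import Data.Nat.Base as ℕ using (ℕ; zero; suc)
  import Data.Nat.Divisibility as ℕ
  import Data.Nat.Properties as ℕ
  open import Relation.Binary.PropositionalEquality
  open IntegerCongruence

  geometric : ℕ → ℤ → ℤ → ℤ
  geometric zero    x y = 0ℤ
  geometric (suc n) x y = x ^ n + y * geometric n x y

  x^n-y^n≡[x-y]*geometric : ∀ n x y → x ^ n - y ^ n ≡ (x - y) * geometric n x y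
  x^n-y^n≡[x-y]*geometric zero    x y = lemma x y
    where lemma : ∀ x y → 1ℤ - 1ℤ ≡ (x - y) * 0ℤ
          lemma = solve-∀
  x^n-y^n≡[x-y]*geometric (suc n) x y = begin
    x * x ^ n - y * y ^ n                              ≡⟨ split x y (x ^ n) (y ^ n) ⟩
    (x - y) * x ^ n + y * (x ^ n - y ^ n)
      ≡⟨ cong (λ d → (x - y) * x ^ n + y * d) (x^n-y^n≡[x-y]*geometric n x y) ⟩
    (x - y) * x ^ n + y * ((x - y) * geometric n x y)  ≡⟨ factor x y (x ^ n) (geometric n x y) ⟩
    (x - y) * geometric (suc n) x y                    ∎
    where
    open ≡-Reasoning
    split : ∀ x y X Y → x * X - y * Y ≡ (x - y) * X + y * (X - Y)
    split = solve-∀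
    factor : ∀ x y X g → (x - y) * X + y * ((x - y) * g) ≡ (x - y) * (X + y * g)
    factor = solve-∀

  geometric-≡ᶻ : ∀ {m x y} n → x ≡ᶻ y [mod m ] → geometric n x y ≡ᶻ geometric n y y [mod m ]
  geometric-≡ᶻ         zero    x≡y = ≡ᶻ-refl
  geometric-≡ᶻ {y = y} (suc n) x≡y =
    ≡ᶻ-+-cong (≡ᶻ-^-cong n x≡y) (≡ᶻ-*-cong (≡ᶻ-refl {x = y}) (geometric-≡ᶻ n x≡y))

  geometric-diagonal : ∀ n y → geometric (suc n) y y ≡ + suc n * y ^ n
  geometric-diagonal zero    y = lemma y
    where lemma : ∀ y → 1ℤ + y * 0ℤ ≡ 1ℤ * 1ℤ
          lemma = solve-∀
  geometric-diagonal (suc n) y =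
    trans (cong (λ g → y * y ^ n + y * g) (geometric-diagonal n y)) (lemma y (y ^ n) (+ n))
    where lemma : ∀ y Y c → y * Y + y * ((1ℤ + c) * Y) ≡ (1ℤ + (1ℤ + c)) * (y * Y)
          lemma = solve-∀

  p∣geometric : ∀ {p x y} → x ≡ᶻ y [mod p ] → + p ∣ geometric p x y
  p∣geometric {zero}  _ = divides 0ℤ refl
  p∣geometric {suc p} {x} {y} x≡y = subst (+ suc p ∣_) (lemma (geometric (suc p) x y) _)
    (∣m∣n⇒∣m+n (modulus∣difference (geometric-≡ᶻ (suc p) x≡y))
      (divides (y ^ p) (trans (geometric-diagonal p y) (*-comm (+ suc p) (y ^ p)))))
    where lemma : ∀ g h → (g - h) + h ≡ g
          lemma = solve-∀

  lte-step : ∀ {p m x y} → x ≡ᶻ y [mod p ] → x ≡ᶻ y [mod m ] → x ^ p ≡ᶻ y ^ p [mod m ℕ.* p ]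
  lte-step {p} {m} {x} {y} x≡y[p] (congruent m∣x-y) =
    congruent (subst₂ _∣_ (sym (pos-* m p)) (sym (x^n-y^n≡[x-y]*geometric p x y))
      (∣-trans (*-monoˡ-∣ (+ p) m∣x-y) (*-monoʳ-∣ (x - y) (p∣geometric x≡y[p]))))

  lte : ∀ {p x y} → x ≡ᶻ y [mod p ] → ∀ j → x ^ (p ℕ.^ j) ≡ᶻ y ^ (p ℕ.^ j) [mod p ℕ.^ suc j ]
  lte {p} {x} {y} x≡y zero = subst₂ (_≡ᶻ_[mod p ℕ.* 1 ]) (sym (^-identityʳ x)) (sym (^-identityʳ y))
    (≡ᶻ-weaken (ℕ.∣-reflexive (ℕ.*-identityʳ p)) x≡y)
  lte {p} {x} {y} x≡y (suc j) = subst₂ (_≡ᶻ_[mod p ℕ.^ suc (suc j) ]) (power x) (power y)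
    (≡ᶻ-weaken (ℕ.∣-reflexive (ℕ.*-comm p (p ℕ.^ suc j)))
      (lte-step (≡ᶻ-weaken (ℕ.m∣m*n (p ℕ.^ j)) (lte x≡y j)) (lte x≡y j)))
    where
    power : ∀ z → (z ^ (p ℕ.^ j)) ^ p ≡ z ^ (p ℕ.^ suc j)
    power z = trans (^-*-assoc z (p ℕ.^ j) p) (cong (z ^_) (ℕ.*-comm (p ℕ.^ j) p))

module ResidueSums where

  open import Data.Integer.Base using (+_; _+_; 0ℤ; 1ℤ)
  open import Data.Integer.Properties using (pos-+; +-identityʳ)
  open import Data.Nat.Base as ℕ using (ℕ; suc; NonZero)
  open import Data.Nat.Coprimality using (Coprime; coprime-divisor)
  import Data.Nat.Divisibility as ℕ
  open import Data.Nat.DivMod using (_%_; _/_; m%n<n; m≡m%n+[m/n]*n; m<n*o⇒m/o<n)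
  import Data.Nat.Properties as ℕ
  open import Function using (id)
  open import Relation.Binary.PropositionalEquality
  open FiniteSums using (∑; ∑-cong; ∑-reindex; ∑-suc; ∑-*ʳ; ∑-id)
  open IntegerCongruence

  odd⇒∣∑id : ∀ {K} → Coprime K 2 → K ℕ.∣ ∑[ j < K ] j
  odd⇒∣∑id {K} K⊥2 = coprime-divisor K⊥2 (subst (K ℕ.∣_) (ℕ.*-comm (∑ K id) 2) K∣∑*2)
    where
    K∣∑*2 : K ℕ.∣ ∑ K id ℕ.* 2
    K∣∑*2 = ℕ.∣m+n∣m⇒∣n (subst (K ℕ.∣_) (trans (sym (∑-id K)) (ℕ.+-comm _ K)) (ℕ.n∣m*n K))
                        ℕ.∣-refl

  -- Reduced mod p K, the x j are K distinct numbers of the form 1 + t p with t < K, hence all of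
  -- them; their sum K + p K (K - 1) / 2 is ≡ K as K is odd.
  ∑≡count : ∀ {p K} (x : ℕ → ℕ) → 1 ℕ.< p → Coprime K 2 → .{{_ : NonZero K}} →
    (∀ {j} → j ℕ.< K → + x j ≡ᶻ 1ℤ [mod p ]) →
    (∀ {i j} → i ℕ.< K → j ℕ.< K → + x i ≡ᶻ + x j [mod p ℕ.* K ] → i ≡ j) →
    + ∑ K x ≡ᶻ + K [mod p ℕ.* K ]
  ∑≡count {p} {K} x 1<p K⊥2 x≡1 x-injective = let open ≡ᶻ-Reasoning (p ℕ.* K) in begin
    + ∑ K x                         ≈⟨ ∑-≡ᶻ K (λ {j} _ → v≡x j) ⟨
    + ∑ K v                         ≡⟨ cong +_ ∑v ⟩
    + (K ℕ.+ ∑[ j < K ] j ℕ.* p)    ≡⟨ pos-+ K _ ⟩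
    + K + + (∑[ j < K ] j ℕ.* p)    ≈⟨ ≡ᶻ-+-cong (≡ᶻ-refl {x = + K}) (∣⇒≡ᶻ0 P∣∑*p) ⟩
    + K + 0ℤ                        ≡⟨ +-identityʳ (+ K) ⟩
    + K                             ∎
    where
    instance
      p≢0 : NonZero p
      p≢0 = ℕ.>-nonZero (ℕ.<-trans ℕ.z<s 1<p)
    P = p ℕ.* K
    instance
      P≢0 : NonZero P
      P≢0 = ℕ.m*n≢0 p K
    v : ℕ → ℕ
    v j = x j % P
    v≡x : ∀ j → + v j ≡ᶻ + x j [mod P ]
    v≡x j = %-≡ᶻ (x j) P
    v%p≡1 : ∀ {j} → j ℕ.< K → v j % p ≡ 1
    v%p≡1 {j} j<K = ≡ᶻ⇒≡ (m%n<n (v j) p) 1<p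
      (≡ᶻ-trans (%-≡ᶻ (v j) p) (≡ᶻ-trans (≡ᶻ-weaken (ℕ.m∣m*n K) (v≡x j)) (x≡1 j<K)))
    t : ℕ → ℕ
    t j = v j / p
    v≡1+tp : ∀ {j} → j ℕ.< K → v j ≡ suc (t j ℕ.* p)
    v≡1+tp {j} j<K = trans (m≡m%n+[m/n]*n (v j) p) (cong (ℕ._+ t j ℕ.* p) (v%p≡1 j<K))
    t<K : ∀ {j} → j ℕ.< K → t j ℕ.< K
    t<K {j} _ = m<n*o⇒m/o<n (subst (v j ℕ.<_) (ℕ.*-comm p K) (m%n<n (x j) P))
    t-injective : ∀ {i j} → i ℕ.< K → j ℕ.< K → t i ≡ t j → i ≡ j
    t-injective {i} {j} i<K j<K ti≡tj = x-injective i<K j<K (≡ᶻ-trans (≡ᶻ-sym (v≡x i))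
      (≡ᶻ-trans (≡ᶻ-reflexive (cong +_ vi≡vj)) (v≡x j)))
      where
      vi≡vj : v i ≡ v j
      vi≡vj = trans (v≡1+tp i<K) (trans (cong (λ s → suc (s ℕ.* p)) ti≡tj) (sym (v≡1+tp j<K)))
    ∑v : ∑ K v ≡ K ℕ.+ ∑[ j < K ] j ℕ.* p
    ∑v = begin
      ∑ K v                           ≡⟨ ∑-cong K v≡1+tp ⟩
      ∑[ j < K ] suc (t j ℕ.* p)      ≡⟨ ∑-suc K (λ j → t j ℕ.* p) ⟩
      K ℕ.+ ∑[ j < K ] (t j ℕ.* p)    ≡⟨ cong (K ℕ.+_) (∑-*ʳ K p t) ⟩
      K ℕ.+ ∑ K t ℕ.* p               ≡⟨ cong (λ s → K ℕ.+ s ℕ.* p) (∑-reindex K id t<K t-injective) ⟩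
      K ℕ.+ ∑[ j < K ] j ℕ.* p        ∎
      where open ≡-Reasoning
    P∣∑*p : P ℕ.∣ ∑[ j < K ] j ℕ.* p
    P∣∑*p = subst (ℕ._∣ ∑[ j < K ] j ℕ.* p) (ℕ.*-comm K p) (ℕ.*-monoˡ-∣ p (odd⇒∣∑id K⊥2))

open import Data.List.Base using (List; _∷_)
open import Data.List.Membership.Propositional using (_∈_)
open import Data.List.Relation.Unary.All using (All)
open import Data.List.Relation.Unary.Unique.Propositional using (Unique)
open import Data.Nat.Base as ℕ using (ℕ)
import Data.Nat.Divisibility as ℕ
open import Data.Nat.ListAction using (product)
open import Data.Nat.Primality using (Prime)
open import Defs using (Carmichael)

module WeakCarmichaelCriterion
  {p : ℕ} {qs : List ℕ} (primes : All Prime (p ∷ qs)) (distinct : Unique (p ∷ qs))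
  (carmichael : Carmichael (product (p ∷ qs))) (k : ℕ)
  (q∸1∣pᵏ∸1 : ∀ {q} → q ∈ qs → q ℕ.∸ 1 ℕ.∣ p ℕ.^ k ℕ.∸ 1) where

  open import Data.Bool.Base using (if_then_else_)
  open import Data.Integer.Base using (+_; _+_; _-_; -_; _*_; _^_; 1ℤ)
  open import Data.Integer.Properties using (pos-+; pos-*; ^-distribˡ-+-*; ^-*-assoc; *-identityʳ; *-comm)
  open import Data.Integer.Tactic.RingSolver using (solve-∀)
  open import Data.List.Base using (map)
  open import Data.List.Properties using (map-upTo)
  import Data.List.Relation.Unary.All as All
  import Data.List.Relation.Unary.AllPairs as AllPairs
  open import Data.Nat.Base using (suc; NonZero)
  open import Data.Nat.Coprimality as Coprimality using (Coprime; coprime?)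
  open import Data.Nat.ListAction using (sum)
  open import Data.Nat.ListAction.Properties using (∈⇒∣product)
  open import Data.Nat.Primality using (Composite; composite-∣; productOfPrimes≢0; prime⇒nonZero; prime[2])
  open import Data.Nat.Primality.Factorisation using (factorisationHasAllPrimeFactors)
  import Data.Nat.Properties as ℕ
  import Data.Nat.Tactic.RingSolver as ℕ-Solver
  open import Data.Product using (_,_; proj₁; proj₂)
  open import Function using (_∘_)
  open import Relation.Binary.PropositionalEquality
  open import Relation.Nullary using (¬_; yes; no; does)
  open import Relation.Nullary.Decidable using (dec-true; dec-false)
  open import Defs using (WeakCarmichael; reducedResidues; range1; φ; _≡_[mod_])
  open FiniteSums
    using (∑; ∑-cong; ∑-const-1; ∑-dropLast; ∑-residueClasses; sum-map-applyUpTo; sum-map-filter; length-filter)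
  open IntegerCongruence
  open Arithmetic
  open Fermat using (fermat)
  open LiftingTheExponent using (lte)
  open ResidueSums using (∑≡count)

  private
    p-prime : Prime p
    p-prime = All.head primes

    r n K N P : ℕ
    r = product qs
    n = p ℕ.* r
    K = p ℕ.^ k
    N = n ℕ.* K
    P = p ℕ.* K

    instance
      p≢0 : NonZero p
      p≢0 = prime⇒nonZero p-prime
      n≢0 : NonZero n
      n≢0 = productOfPrimes≢0 primes
      K≢0 : NonZero K
      K≢0 = ℕ.m^n≢0 p k
      N≢0 : NonZero N
      N≢0 = ℕ.m*n≢0 n K

    p∣n : p ℕ.∣ n
    p∣n = ℕ.m∣m*n r

    n∣N : n ℕ.∣ N
    n∣N = ℕ.m∣m*n K

    p∤r : ¬ p ℕ.∣ r
    p∤r p∣r = All.lookup (AllPairs.head distinct)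
      (factorisationHasAllPrimeFactors p-prime p∣r (All.tail primes)) refl

    p⊥r : Coprime p r
    p⊥r = prime∤⇒coprime p-prime p∤r

    K⊥2 : Coprime K 2
    K⊥2 = coprime-^ˡ k (Coprimality.sym (prime∤⇒coprime prime[2] 2∤p))
      where 2∤p = λ 2∣p → carmichael⇒odd carmichael (ℕ.∣-trans 2∣p p∣n)

    N≡r*P : N ≡ r ℕ.* P
    N≡r*P = lemma p r K
      where lemma : ∀ p r K → p ℕ.* r ℕ.* K ≡ r ℕ.* (p ℕ.* K)
            lemma = ℕ-Solver.solve-∀

    module Unit {a : ℕ} (a⊥N : Coprime a N) where

      aⁿ⁻¹≡1 : (+ a) ^ (n ℕ.∸ 1) ≡ᶻ 1ℤ [mod n ]
      aⁿ⁻¹≡1 = subst (_≡ᶻ 1ℤ [mod n ]) (pos-^ a (n ℕ.∸ 1))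
        (≡[mod]⇒≡ᶻ (proj₂ carmichael a (coprime-∣ʳ a⊥N n∣N)))

      aᴺ⁻¹≡1 : ∀ {q} → Prime q → q ℕ.∣ n → q ℕ.∸ 1 ℕ.∣ K ℕ.∸ 1 →
               (+ a) ^ (N ℕ.∸ 1) ≡ᶻ 1ℤ [mod q ]
      aᴺ⁻¹≡1 {q} q-prime q∣n q∸1∣K∸1 = begin
        (+ a) ^ (N ℕ.∸ 1)                               ≡⟨ cong ((+ a) ^_) (m*n∸1≡[m∸1]*n+[n∸1] n K) ⟩
        (+ a) ^ ((n ℕ.∸ 1) ℕ.* K ℕ.+ (K ℕ.∸ 1))
          ≡⟨ ^-distribˡ-+-* (+ a) ((n ℕ.∸ 1) ℕ.* K) (K ℕ.∸ 1) ⟩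
        (+ a) ^ ((n ℕ.∸ 1) ℕ.* K) * (+ a) ^ (K ℕ.∸ 1)   ≈⟨ ≡ᶻ-*-cong from-carmichael from-fermat ⟩
        1ℤ * 1ℤ                                         ∎
        where
        open ≡ᶻ-Reasoning q
        from-carmichael : (+ a) ^ ((n ℕ.∸ 1) ℕ.* K) ≡ᶻ 1ℤ [mod q ]
        from-carmichael = ^-≡ᶻ-1 (+ a) (n ℕ.∸ 1) (≡ᶻ-weaken q∣n aⁿ⁻¹≡1) (ℕ.m∣m*n K)
        from-fermat : (+ a) ^ (K ℕ.∸ 1) ≡ᶻ 1ℤ [mod q ]
        from-fermat = ^-≡ᶻ-1 (+ a) (q ℕ.∸ 1)
          (fermat q-prime (coprime⇒∤ a⊥N (ℕ.∣-trans q∣n n∣N) (prime>1 q-prime))) q∸1∣K∸1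

      aᴺ⁻¹≡1[p] : (+ a) ^ (N ℕ.∸ 1) ≡ᶻ 1ℤ [mod p ]
      aᴺ⁻¹≡1[p] = aᴺ⁻¹≡1 p-prime p∣n (m∸1∣mᵏ∸1 k (ℕ.>-nonZero⁻¹ p))

      aᴺ⁻¹≡1[r] : (+ a) ^ (N ℕ.∸ 1) ≡ᶻ 1ℤ [mod r ]
      aᴺ⁻¹≡1[r] = ≡ᶻ-product (All.tail primes) (AllPairs.tail distinct) λ q∈qs →
        aᴺ⁻¹≡1 (All.lookup (All.tail primes) q∈qs) (ℕ.∣-trans (∈⇒∣product q∈qs) (ℕ.n∣m*n p))
               (q∸1∣pᵏ∸1 q∈qs)

      aᴺ≡cᴷ : ∀ {c} → + a ≡ᶻ + c [mod p ] → + a * (+ a) ^ (N ℕ.∸ 1) ≡ᶻ (+ c) ^ K [mod P ]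
      aᴺ≡cᴷ {c} a≡c = begin
        + a * (+ a) ^ (N ℕ.∸ 1)      ≡⟨ cong ((+ a) ^_) (ℕ.suc-pred N) ⟩
        (+ a) ^ (n ℕ.* K)            ≡⟨ ^-*-assoc (+ a) n K ⟨
        ((+ a) ^ n) ^ K              ≈⟨ lte aⁿ≡c k ⟩
        (+ c) ^ K                    ∎
        where
        open ≡ᶻ-Reasoning P
        aⁿ≡c : (+ a) ^ n ≡ᶻ + c [mod p ]
        aⁿ≡c = subst₂ (_≡ᶻ_[mod p ]) (cong ((+ a) ^_) (ℕ.suc-pred n)) (*-identityʳ (+ c))
          (≡ᶻ-*-cong a≡c (≡ᶻ-weaken p∣n aⁿ⁻¹≡1))

    module Class {c : ℕ} (c⊥n : Coprime c n) where

      a : ℕ → ℕ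
      a j = c ℕ.+ n ℕ.* j

      a⊥N : ∀ j → Coprime (a j) N
      a⊥N j = coprime-*ʳ aj⊥n (coprime-^ʳ k (coprime-∣ʳ aj⊥n p∣n))
        where aj⊥n = coprime-+-* j c⊥n

      a≡c[p] : ∀ j → + a j ≡ᶻ + c [mod p ]
      a≡c[p] j = ≡[mod]⇒≡ᶻ (subst (p ℕ.∣_) distance (ℕ.∣m⇒∣m*n j p∣n))
        where distance = sym (trans (ℕ.∣-∣-comm (a j) c) (ℕ.∣m-m+n∣≡n c (n ℕ.* j)))

      pos-a : ∀ j → + a j ≡ + c + + p * + r * + j
      pos-a j = trans (pos-+ c (n ℕ.* j)) (cong (λ z → + c + z) (trans (pos-* n j) (cong (_* + j) (pos-* p r))))

      y : ℕ → ℕ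
      y j = a j ℕ.^ (N ℕ.∸ 1)

      y≡1[p] : ∀ j → + y j ≡ᶻ 1ℤ [mod p ]
      y≡1[p] j = subst (_≡ᶻ 1ℤ [mod p ]) (sym (pos-^ (a j) (N ℕ.∸ 1))) (Unit.aᴺ⁻¹≡1[p] (a⊥N j))

      y≡1[r] : ∀ j → + y j ≡ᶻ 1ℤ [mod r ]
      y≡1[r] j = subst (_≡ᶻ 1ℤ [mod r ]) (sym (pos-^ (a j) (N ℕ.∸ 1))) (Unit.aᴺ⁻¹≡1[r] (a⊥N j))

      aᴺ≡cᴷ : ∀ j → + a j * + y j ≡ᶻ (+ c) ^ K [mod P ]
      aᴺ≡cᴷ j = subst (_≡ᶻ (+ c) ^ K [mod P ]) (cong (+ a j *_) (sym (pos-^ (a j) (N ℕ.∸ 1))))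
                  (Unit.aᴺ≡cᴷ (a⊥N j) (a≡c[p] j))

      -- a i yᵢ ≡ cᴷ ≡ a j yⱼ (mod P), so yᵢ ≡ yⱼ forces a i ≡ a j (mod P), i.e. K ∣ r (i - j).
      y-injective : ∀ {i j} → i ℕ.< K → j ℕ.< K → + y i ≡ᶻ + y j [mod P ] → i ≡ j
      y-injective {i} {j} i<K j<K yᵢ≡yⱼ = ≡ᶻ⇒≡ i<K j<K
        (≡ᶻ-cancelˡ K⊥r (≡ᶻ-cancel-modulus {p} (subst₂ (_≡ᶻ_[mod P ]) (a-c i) (a-c j)
          (≡ᶻ-+-cong (≡ᶻ-cancelˡ P⊥yᵢ yᵢaᵢ≡yᵢaⱼ) (≡ᶻ-refl {x = - + c})))))
        where
        open ≡ᶻ-Reasoning P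
        a-c : ∀ t → + a t - + c ≡ + p * (+ r * + t)
        a-c t = trans (cong (_- + c) (pos-a t)) (lemma (+ c) (+ p) (+ r) (+ t))
          where lemma : ∀ c p r t → c + p * r * t - c ≡ p * (r * t)
                lemma = solve-∀
        K⊥r : Coprime K r
        K⊥r = coprime-^ˡ k p⊥r
        P⊥yᵢ : Coprime P (y i)
        P⊥yᵢ = coprime-^ˡ (suc k) (prime∤⇒coprime p-prime (≡ᶻ1⇒∤ (prime>1 p-prime) (y≡1[p] i)))
        yᵢaᵢ≡yᵢaⱼ : + y i * + a i ≡ᶻ + y i * + a j [mod P ]
        yᵢaᵢ≡yᵢaⱼ = begin
          + y i * + a i    ≡⟨ *-comm (+ y i) (+ a i) ⟩
          + a i * + y i    ≈⟨ aᴺ≡cᴷ i ⟩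
          (+ c) ^ K        ≈⟨ aᴺ≡cᴷ j ⟨
          + a j * + y j    ≈⟨ ≡ᶻ-*-cong (≡ᶻ-refl {x = + a j}) yᵢ≡yⱼ ⟨
          + a j * + y i    ≡⟨ *-comm (+ a j) (+ y i) ⟩
          + y i * + a j    ∎

      class-sum : + ∑ K y ≡ᶻ + K [mod N ]
      class-sum = ≡ᶻ-weaken (ℕ.∣-reflexive N≡r*P) (≡ᶻ-combine r⊥P mod-r mod-P)
        where
        r⊥P : Coprime r P
        r⊥P = Coprimality.sym (coprime-^ˡ (suc k) p⊥r)
        mod-r : + ∑ K y ≡ᶻ + K [mod r ]
        mod-r = subst (λ s → + ∑ K y ≡ᶻ + s [mod r ]) (∑-const-1 K) (∑-≡ᶻ K (λ {j} _ → y≡1[r] j))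
        mod-P : + ∑ K y ≡ᶻ + K [mod P ]
        mod-P = ∑≡count y (prime>1 p-prime) K⊥2 (λ {j} _ → y≡1[p] j) y-injective

    unitPower isUnit : ℕ → ℕ
    unitPower x = if does (coprime? x N) then x ℕ.^ (N ℕ.∸ 1) else 0
    isUnit    x = if does (coprime? x N) then 1 else 0

    unitPower-unit : ∀ {x} → Coprime x N → unitPower x ≡ x ℕ.^ (N ℕ.∸ 1)
    unitPower-unit {x} x⊥N rewrite dec-true (coprime? x N) x⊥N = refl

    isUnit-unit : ∀ {x} → Coprime x N → isUnit x ≡ 1
    isUnit-unit {x} x⊥N rewrite dec-true (coprime? x N) x⊥N = refl

    unitPower-nonunit : ∀ {x} → ¬ Coprime x N → unitPower x ≡ 0
    unitPower-nonunit {x} x⊥̸N rewrite dec-false (coprime? x N) x⊥̸N = refl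

    isUnit-nonunit : ∀ {x} → ¬ Coprime x N → isUnit x ≡ 0
    isUnit-nonunit {x} x⊥̸N rewrite dec-false (coprime? x N) x⊥̸N = refl

    class-congruence : ∀ c →
      + ∑[ j < K ] unitPower (c ℕ.+ n ℕ.* j) ≡ᶻ + ∑[ j < K ] isUnit (c ℕ.+ n ℕ.* j) [mod N ]
    class-congruence c with coprime? c n
    ... | yes c⊥n = subst₂ (_≡ᶻ_[mod N ])
      (cong +_ (sym (∑-cong K (λ {j} _ → unitPower-unit (a⊥N j)))))
      (cong +_ (trans (sym (∑-const-1 K)) (sym (∑-cong K (λ {j} _ → isUnit-unit (a⊥N j))))))
      class-sum
      where open Class c⊥n
    ... | no c⊥̸n = ≡ᶻ-reflexive (cong +_ (trans (∑-cong K (λ {j} _ → unitPower-nonunit (nonunit j)))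
                                                (sym (∑-cong K (λ {j} _ → isUnit-nonunit (nonunit j))))))
      where nonunit : ∀ j → ¬ Coprime (c ℕ.+ n ℕ.* j) N
            nonunit j = c⊥̸n ∘ coprime-+-*⁻ j n∣N

    ∑unitPower≡∑isUnit : + ∑[ x < N ] unitPower (suc x) ≡ᶻ + ∑[ x < N ] isUnit (suc x) [mod N ]
    ∑unitPower≡∑isUnit = subst₂ (_≡ᶻ_[mod N ])
      (cong +_ (sym (∑-residueClasses n K (unitPower ∘ suc))))
      (cong +_ (sym (∑-residueClasses n K (isUnit ∘ suc))))
      (∑-≡ᶻ n (λ {b} _ → class-congruence (suc b)))

    sum-map-range1 : ∀ g m → sum (map g (range1 m)) ≡ ∑[ x < m ] g (suc x)
    sum-map-range1 g m = trans (cong (sum ∘ map g) (map-upTo suc m)) (sum-map-applyUpTo g suc m)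

    N-composite : Composite N
    N-composite = composite-∣ (proj₁ carmichael) n∣N

    1<N : 1 ℕ.< N
    1<N = ℕ.<-trans (ℕ.n<1+n 1) (composite⇒>2 N-composite)

    powerSum≡∑unitPower :
      sum (map (λ x → x ℕ.^ (N ℕ.∸ 1)) (reducedResidues N)) ≡ ∑[ x < N ] unitPower (suc x)
    powerSum≡∑unitPower = begin
      sum (map (λ x → x ℕ.^ (N ℕ.∸ 1)) (reducedResidues N))
        ≡⟨ sum-map-filter (λ x → coprime? x N) _ (range1 (N ℕ.∸ 1)) ⟩
      sum (map unitPower (range1 (N ℕ.∸ 1)))     ≡⟨ sum-map-range1 unitPower (N ℕ.∸ 1) ⟩
      ∑[ x < N ℕ.∸ 1 ] unitPower (suc x)
        ≡⟨ ∑-dropLast (N ℕ.∸ 1) (unitPower ∘ suc) unitPower[N]≡0 ⟨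
      ∑[ x < suc (N ℕ.∸ 1) ] unitPower (suc x)   ≡⟨ cong (λ L → ∑ L (unitPower ∘ suc)) (ℕ.suc-pred N) ⟩
      ∑[ x < N ] unitPower (suc x)               ∎
      where
      open ≡-Reasoning
      unitPower[N]≡0 : unitPower (suc (N ℕ.∸ 1)) ≡ 0
      unitPower[N]≡0 = subst (λ z → unitPower z ≡ 0) (sym (ℕ.suc-pred N))
        (unitPower-nonunit (¬coprime-self 1<N))

    φ≡∑isUnit : φ N ≡ ∑[ x < N ] isUnit (suc x)
    φ≡∑isUnit = trans (length-filter (λ x → coprime? x N) (range1 N)) (sum-map-range1 isUnit N)

  weakCarmichael : WeakCarmichael N
  weakCarmichael = N-composite , ≡ᶻ⇒≡[mod] (subst₂ (_≡ᶻ_[mod N ])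
    (cong +_ (sym powerSum≡∑unitPower)) (cong +_ (sym φ≡∑isUnit)) ∑unitPower≡∑isUnit)

open import Defs
open import Data.Nat using (ℕ; _*_; _^_; _≤_; _<_)
open import Data.Nat.Divisibility using (_∣_)
open import Data.Nat.Primality using (Prime)
open import Data.List using (List; length; lookup)
open import Data.Nat.ListAction using (product)
open import Data.List.Relation.Unary.All using (All)
open import Data.List.Relation.Unary.Unique.Propositional using (Unique)
open import Data.Fin using (Fin)
open import Relation.Binary.PropositionalEquality using (_≡_)

open import Data.List.Base using (removeAt)
open import Data.List.Membership.Propositional.Properties using (∈-map⁺)
open import Data.List.Relation.Binary.Permutation.Propositional
  using (_↭_; refl; prep; swap; trans; ↭-sym; ↭⇒↭ₛ)
open import Data.List.Relation.Binary.Permutation.Propositional.Properties using (All-resp-↭)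
import Data.List.Relation.Binary.Permutation.Setoid.Properties as SetoidPermutation
import Data.List.Relation.Unary.All as All
open import Data.Nat.ListAction.Properties using (∈⇒∣product; product-↭)
open import Data.Nat.Primality using (prime⇒nonZero)
open import Data.Nat.Properties using (m^n>0)
import Relation.Binary.PropositionalEquality as ≡
open Arithmetic using (≡1[mod]⇒∣∸1; ^≡1⇒^[m*d]≡1)

lookup∷removeAt↭ : ∀ {a} {A : Set a} (xs : List A) i → lookup xs i ∷ removeAt xs i ↭ xs
lookup∷removeAt↭ (x ∷ xs) Fin.zero    = refl
lookup∷removeAt↭ (x ∷ xs) (Fin.suc i) = trans (swap _ x refl) (prep x (lookup∷removeAt↭ xs i))

proposition2p9 : (n : ℕ) (ps : List ℕ) → All Prime ps → Unique ps → n ≡ product ps →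
    Carmichael n → (i : Fin (length ps)) → (d : ℕ) →
    0 < d → d ∣ φ (M ps i) → (lookup ps i ^ d) ≡ 1 [mod M ps i ] →
    (∀ e → 0 < e → e ∣ φ (M ps i) → (lookup ps i ^ e) ≡ 1 [mod M ps i ] → d ≤ e) →
    (m : ℕ) → 0 < m → WeakCarmichael (n * lookup ps i ^ (m * d))
proposition2p9 n ps primes distinct n≡∏ps carmichael i d _ _ pᵈ≡1 _ m _ =
  ≡.subst (λ n → WeakCarmichael (n * p ^ (m * d))) (≡.sym n≡∏p∷qs)
    (WeakCarmichaelCriterion.weakCarmichael primes′ distinct′ (≡.subst Carmichael n≡∏p∷qs carmichael)
      (m * d) q∸1∣pᵐᵈ∸1)
  where
  p = lookup ps i
  qs = removeAt ps i
  p∷qs↭ps = lookup∷removeAt↭ ps i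
  primes′ : All Prime (p ∷ qs)
  primes′ = All-resp-↭ (↭-sym p∷qs↭ps) primes
  distinct′ : Unique (p ∷ qs)
  distinct′ = SetoidPermutation.Unique-resp-↭ (≡.setoid ℕ) (↭⇒↭ₛ (↭-sym p∷qs↭ps)) distinct
  n≡∏p∷qs : n ≡ product (p ∷ qs)
  n≡∏p∷qs = ≡.trans n≡∏ps (≡.sym (product-↭ p∷qs↭ps))
  q∸1∣pᵐᵈ∸1 : ∀ {q} → q ∈ qs → q ℕ.∸ 1 ∣ p ^ (m * d) ℕ.∸ 1
  q∸1∣pᵐᵈ∸1 q∈qs = ≡1[mod]⇒∣∸1 (m^n>0 p {{prime⇒nonZero (All.head primes′)}} (m * d))
    (ℕ.∣-trans (∈⇒∣product (∈-map⁺ (ℕ._∸ 1) q∈qs)) (^≡1⇒^[m*d]≡1 m pᵈ≡1))
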